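{- Let $L=E[C_1,\dots,C_n]$ be a congruence normal lattice, obtained from the one-element lattice by successively doubling nonempty convex subsets $C_1,\dots,C_n$. Then $L$ is left modular if and only if, for every $i$, the heart $H(C_i)$ contains an element that lies on a maximal left modular chain of $E[C_1,\dots,C_{i-1}]$.
   Context: All lattices are finite. For a convex subset $C$ of a lattice $L$ (convex: $x,y\in C$ implies $[x,y]\subseteq C$), let $I_L(C)=\{y\mid \exists x\in C, y\le x\}$. The doubling $L[C]$ is the subposet of $L\times\{0<1\}$ on $(I_L(C)\times\{0\})\sqcup\big(((L\setminus I_L(C))\cup C)\times\{1\}\big)$; it is a lattice. $E[\,]$ is the one-element lattice and $E[C_1,\dots,C_{i+1}]=E[C_1,\dots,C_i][C_{i+1}]$. The heart $H(C)$ of a convex subset $C$ is the set of elements of $C$ that are below all maximal elements of $C$ and above all minimal elements of $C$. An element $a$ of a lattice is left modular if for all $b<c$, $(b\vee a)\wedge c=b\vee(a\wedge c)$. A maximal left modular chain is a maximal chain all of whose elements are left modular; a lattice is left modular if it has a maximal left modular chain. -}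

module Defs where

open import Level using (0ℓ)
open import Data.Bool.Base using (Bool; true; false; T) renaming (_≤_ to _≤𝔹_)
open import Data.Nat.Base using (ℕ; zero; suc)
open import Data.Vec.Base using (Vec; []; _∷_)
open import Data.Vec.Relation.Binary.Pointwise.Inductive using (Pointwise)
open import Data.Product using (Σ; ∃; ∃-syntax; _×_; _,_)
open import Data.Sum using (_⊎_)
open import Data.Unit using (⊤)
open import Relation.Nullary using (¬_)
open import Relation.Binary.PropositionalEquality using (_≡_; _≢_)

-- An element of E[C_1,...,C_n] is an element of {0<1}^n (a subposet of
-- E × 2 × ... × 2), i.e. a Vec Bool n.  The doubling L[C] ⊆ L × {0<1}
-- is encoded by prepending the new coordinate: (x , b) ↦ b ∷ x.

Elt : ℕ → Set
Elt n = Vec Bool n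

_≤_ : ∀ {n} → Elt n → Elt n → Set
_≤_ = Pointwise _≤𝔹_

_<_ : ∀ {n} → Elt n → Elt n → Set
x < y = x ≤ y × x ≢ y

Subset : ℕ → Set
Subset n = Elt n → Bool

_∈_ : ∀ {n} → Elt n → Subset n → Set
x ∈ S = T (S x)

module _ {n : ℕ} (L : Elt n → Set) where

  DownSet : Subset n → Elt n → Set
  DownSet C y = L y × ∃[ x ] (x ∈ C × y ≤ x)

  Convex : Subset n → Set
  Convex C = (∀ x → x ∈ C → L x)
           × (∀ x y z → x ∈ C → y ∈ C → L z → x ≤ z → z ≤ y → z ∈ C)

  IsJoin : Elt n → Elt n → Elt n → Set
  IsJoin x y z = L z × x ≤ z × y ≤ z × (∀ w → L w → x ≤ w → y ≤ w → z ≤ w)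

  IsMeet : Elt n → Elt n → Elt n → Set
  IsMeet x y z = L z × z ≤ x × z ≤ y × (∀ w → L w → w ≤ x → w ≤ y → w ≤ z)

  -- a is left modular: for all b < c in L, (b ∨ a) ∧ c = b ∨ (a ∧ c).
  -- Joins/meets are written relationally (they exist and are unique in a
  -- lattice).
  LeftModularElem : Elt n → Set
  LeftModularElem a =
    L a ×
    (∀ b c → L b → L c → b < c →
     ∀ d e f g → IsJoin b a d → IsMeet d c e → IsMeet a c f → IsJoin b f g →
     e ≡ g)

  IsChain : Subset n → Set
  IsChain K = (∀ x → x ∈ K → L x) × (∀ x y → x ∈ K → y ∈ K → x ≤ y ⊎ y ≤ x)

  IsMaximalChain : Subset n → Set
  IsMaximalChain K =
    IsChain K × (∀ K′ → IsChain K′ → (∀ x → x ∈ K → x ∈ K′) → ∀ x → x ∈ K′ → x ∈ K)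

  IsMaximalLeftModularChain : Subset n → Set
  IsMaximalLeftModularChain K = IsMaximalChain K × (∀ x → x ∈ K → LeftModularElem x)

  LeftModular : Set
  LeftModular = ∃[ K ] IsMaximalLeftModularChain K

module _ {n : ℕ} (C : Subset n) where

  IsMaximalIn : Elt n → Set
  IsMaximalIn m = m ∈ C × (∀ y → y ∈ C → m ≤ y → y ≡ m)

  IsMinimalIn : Elt n → Set
  IsMinimalIn m = m ∈ C × (∀ y → y ∈ C → y ≤ m → y ≡ m)

  Heart : Elt n → Set
  Heart x = x ∈ C × (∀ m → IsMaximalIn m → x ≤ m) × (∀ m → IsMinimalIn m → m ≤ x)

-- Sequences of doublings: Doublings n is a list C_1,...,C_n where C_{i+1}
-- is a subset of the elements of E[C_1,...,C_i] (which live in Elt i).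

infixl 5 _▷_
data Doublings : ℕ → Set where
  ε   : Doublings zero
  _▷_ : ∀ {i} → Doublings i → Subset i → Doublings (suc i)

-- Carrier of E[C_1,...,C_n] as a subset of Elt n.
-- E[] is the one-element lattice; L[C] consists of
--   (I_L(C) × {0}) ⊔ (((L ∖ I_L(C)) ∪ C) × {1}).
E : ∀ {n} → Doublings n → Elt n → Set
E ε       []          = ⊤
E (D ▷ C) (false ∷ x) = DownSet (E D) C x
E (D ▷ C) (true  ∷ x) = (E D x × ¬ DownSet (E D) C x) ⊎ x ∈ C

AllSteps : (∀ {i} → Doublings i → Subset i → Set) → ∀ {n} → Doublings n → Set
AllSteps P ε       = ⊤
AllSteps P (D ▷ C) = AllSteps P D × P D C

ValidStep : ∀ {i} → Doublings i → Subset i → Set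
ValidStep D C = Convex (E D) C × ∃[ x ] x ∈ C

HeartMeetsLMChain : ∀ {i} → Doublings i → Subset i → Set
HeartMeetsLMChain D C =
  ∃[ x ] (Heart C x × ∃[ K ] (IsMaximalLeftModularChain (E D) K × x ∈ K))

{-# OPTIONS --safe #-}
-- Over each z of L the doubled lattice L[C] has the points (0,z) for z ∈ I(C) and (1,z) for
-- z ∉ I(C) or z ∈ C, and its joins and meets lie over those of L. Hence left modular elements and
-- maximal chains of L[C] lie over left modular elements and maximal chains of L. Testing left
-- modularity of (0,x) and of (1,y) on the pair (0,c) < (1,c) with c ∈ C shows that x lies below
-- every maximal and y above every minimal element of C; since a maximal left modular chain of L[C]
-- climbs from level 0 to level 1 through a pair (0,h) < (1,h), this h lies in the heart H(C).
-- Conversely, a maximal left modular chain K of L through h ∈ H(C) lifts to the chain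
-- {(0,x) | x ∈ K, x ≤ h} ∪ {(1,x) | x ∈ K, h ≤ x}. At a lift a of a left modular x, both sides of
-- the modular law lie over the same point e, and by the modular inequality b ∨ (a ∧ c) ≤ (b ∨ a) ∧ c
-- the only possible failure has b ∨ (a ∧ c) at level 0 and (b ∨ a) ∧ c at level 1. Then e ∈ C, and
-- a maximal element of C above e (for x ≤ h), resp. a minimal one below e (for h ≤ x), pushes
-- b ∨ a down to level 0, resp. a ∧ c up to level 1.
module Submission where

open import Defs
open import Data.Nat.Base using (ℕ)
open import Function.Bundles using (_⇔_; mk⇔; Equivalence)

open import Data.Bool.Base using (Bool; true; false; T; not; _∧_; _∨_; b≤b; f≤t) renaming (_≤_ to _≤𝔹_)
import Data.Bool.Properties as 𝔹
open import Data.Empty using (⊥-elim)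
import Data.Nat.Base as Nat
open import Data.Nat.Induction using (<-wellFounded)
open import Data.Nat.Properties using (m≤n⇒m≤1+n)
open import Data.Product using (∃; ∃-syntax; ∃₂; _×_; _,_; proj₁; proj₂)
open import Data.Sum using (_⊎_; inj₁; inj₂; [_,_]′)
import Data.Sum as Sum
open import Data.Unit using (tt)
open import Data.Vec.Base using ([]; _∷_)
import Data.Vec.Base as Vec
open import Data.Vec.Properties using (≡-dec)
open import Data.Vec.Relation.Binary.Pointwise.Inductive using ([]; _∷_)
import Data.Vec.Relation.Binary.Pointwise.Inductive as Pw
open import Function.Base using (_∘_; flip; id)
open import Induction.WellFounded using (Acc; acc)
open import Level using (0ℓ)
open import Relation.Binary.Core using (Rel)
open import Relation.Binary.Definitions
  using (Reflexive; Transitive; Antisymmetric; Decidable; DecidableEquality)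
open import Relation.Binary.PropositionalEquality using (_≡_; _≢_; refl; sym; cong; cong₂; subst)
open import Relation.Nullary using (¬_; Dec; yes; no)
open import Relation.Nullary.Decidable
  using (map′; _×-dec_; _⊎-dec_; ¬?; T?; decidable-stable; isYes; toWitness; fromWitness)

≤-refl : ∀ {n} → Reflexive (_≤_ {n})
≤-refl = Pw.refl 𝔹.≤-refl

≤-trans : ∀ {n} → Transitive (_≤_ {n})
≤-trans = Pw.trans 𝔹.≤-trans

≤-antisym : ∀ {n} → Antisymmetric _≡_ (_≤_ {n})
≤-antisym []       []       = refl
≤-antisym (p ∷ ps) (q ∷ qs) = cong₂ _∷_ (𝔹.≤-antisym p q) (≤-antisym ps qs)

≤-reflexive : ∀ {n} {x y : Elt n} → x ≡ y → x ≤ y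
≤-reflexive refl = ≤-refl

_≤?_ : ∀ {n} → Decidable (_≤_ {n})
_≤?_ = Pw.decidable 𝔹._≤?_

_≟_ : ∀ {n} → DecidableEquality (Elt n)
_≟_ = ≡-dec 𝔹._≟_

true≰false : ¬ (true ≤𝔹 false)
true≰false ()

∃? : ∀ {n} {P : Elt n → Set} → (∀ x → Dec (P x)) → Dec (∃ P)
∃? {Nat.zero} P? = map′ ([] ,_) (λ { ([] , p) → p }) (P? [])
∃? {Nat.suc n} {P} P? =
  map′ [ (λ (x , p) → false ∷ x , p) , (λ (x , p) → true ∷ x , p) ]′ split
       (∃? (P? ∘ (false ∷_)) ⊎-dec ∃? (P? ∘ (true ∷_)))
  where
  split : ∃ P → ∃ (P ∘ (false ∷_)) ⊎ ∃ (P ∘ (true ∷_))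
  split (false ∷ x , p) = inj₁ (x , p)
  split (true ∷ x , p)  = inj₂ (x , p)

ones : ∀ {n} → Elt n → ℕ
ones []          = 0
ones (false ∷ x) = ones x
ones (true ∷ x)  = Nat.suc (ones x)

zeros : ∀ {n} → Elt n → ℕ
zeros []          = 0
zeros (false ∷ x) = Nat.suc (zeros x)
zeros (true ∷ x)  = zeros x

ones-mono : ∀ {n} {x y : Elt n} → x ≤ y → ones x Nat.≤ ones y
ones-mono []                 = Nat.z≤n
ones-mono (b≤b {false} ∷ p)  = ones-mono p
ones-mono (b≤b {true} ∷ p)   = Nat.s≤s (ones-mono p)
ones-mono (f≤t ∷ p)          = m≤n⇒m≤1+n (ones-mono p)

zeros-anti : ∀ {n} {x y : Elt n} → x ≤ y → zeros y Nat.≤ zeros x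
zeros-anti []                = Nat.z≤n
zeros-anti (b≤b {false} ∷ p) = Nat.s≤s (zeros-anti p)
zeros-anti (b≤b {true} ∷ p)  = zeros-anti p
zeros-anti (f≤t ∷ p)         = m≤n⇒m≤1+n (zeros-anti p)

ones-< : ∀ {n} {x y : Elt n} → x ≤ y → x ≢ y → ones x Nat.< ones y
ones-< []                x≢y = ⊥-elim (x≢y refl)
ones-< (b≤b {false} ∷ p) x≢y = ones-< p (x≢y ∘ cong (false ∷_))
ones-< (b≤b {true} ∷ p)  x≢y = Nat.s≤s (ones-< p (x≢y ∘ cong (true ∷_)))
ones-< (f≤t ∷ p)         _   = Nat.s≤s (ones-mono p)

zeros-> : ∀ {n} {x y : Elt n} → x ≤ y → x ≢ y → zeros y Nat.< zeros x
zeros-> []                x≢y = ⊥-elim (x≢y refl)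
zeros-> (b≤b {false} ∷ p) x≢y = Nat.s≤s (zeros-> p (x≢y ∘ cong (false ∷_)))
zeros-> (b≤b {true} ∷ p)  x≢y = zeros-> p (x≢y ∘ cong (true ∷_))
zeros-> (f≤t ∷ p)         _   = Nat.s≤s (zeros-anti p)

module Extremal {n} (_≼_ : Rel (Elt n) 0ℓ) (_≼?_ : Decidable _≼_)
                (≼-refl : Reflexive _≼_) (≼-trans : Transitive _≼_)
                (μ : Elt n → ℕ) (μ-decreasing : ∀ {x y} → x ≼ y → x ≢ y → μ y Nat.< μ x)
                (S : Subset n) where

  IsExtremalAbove : Elt n → Elt n → Set
  IsExtremalAbove x m = x ≼ m × m ∈ S × (∀ y → y ∈ S → m ≼ y → y ≡ m)

  extremal-above : ∀ x → x ∈ S → ∃ (IsExtremalAbove x)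
  extremal-above x = go x (<-wellFounded (μ x))
    where
    go : ∀ x → Acc Nat._<_ (μ x) → x ∈ S → ∃ (IsExtremalAbove x)
    go x (acc rec) x∈S with ∃? (λ y → T? (S y) ×-dec x ≼? y ×-dec ¬? (y ≟ x))
    ... | yes (y , y∈S , x≼y , y≢x) =
      let m , y≼m , m-extremal = go y (rec (μ-decreasing x≼y (y≢x ∘ sym))) y∈S
      in  m , ≼-trans x≼y y≼m , m-extremal
    ... | no ∄y = x , ≼-refl , x∈S , λ y y∈S x≼y →
      decidable-stable (y ≟ x) (λ y≢x → ∄y (y , y∈S , x≼y , y≢x))

maximal-above : ∀ {n} (S : Subset n) x → x ∈ S → ∃[ m ] x ≤ m × IsMaximalIn S m
maximal-above = Extremal.extremal-above _≤_ _≤?_ ≤-refl ≤-trans zeros zeros->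

minimal-below : ∀ {n} (S : Subset n) x → x ∈ S → ∃[ m ] m ≤ x × IsMinimalIn S m
minimal-below = Extremal.extremal-above (flip _≤_) (flip _≤?_) ≤-refl (flip ≤-trans) ones
                  (λ y≤x x≢y → ones-< y≤x (x≢y ∘ sym))

comparable-∈-maximalChain : ∀ {n} {L : Elt n → Set} {K : Subset n} → IsMaximalChain L K →
  ∀ {z} → L z → (∀ x → x ∈ K → x ≤ z ⊎ z ≤ x) → z ∈ K
comparable-∈-maximalChain {n} {L} {K} ((K⊆L , K-chain) , K-maximal) {z} z∈L z-comparable =
  K-maximal K∪z (K∪z⊆L , K∪z-chain) (λ _ → Equivalence.from 𝔹.T-∨ ∘ inj₁) z
            (Equivalence.from (𝔹.T-∨ {K z}) (inj₂ (fromWitness {a? = z ≟ z} refl)))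
  where
  K∪z : Subset n
  K∪z y = K y ∨ isYes (y ≟ z)

  ∈K∪z : ∀ {y} → y ∈ K∪z → y ∈ K ⊎ y ≡ z
  ∈K∪z = Sum.map₂ toWitness ∘ Equivalence.to 𝔹.T-∨

  K∪z⊆L : ∀ y → y ∈ K∪z → L y
  K∪z⊆L y y∈ with ∈K∪z y∈
  ... | inj₁ y∈K = K⊆L y y∈K
  ... | inj₂ refl = z∈L

  K∪z-chain : ∀ x y → x ∈ K∪z → y ∈ K∪z → x ≤ y ⊎ y ≤ x
  K∪z-chain x y x∈ y∈ with ∈K∪z x∈ | ∈K∪z y∈
  ... | inj₁ x∈K  | inj₁ y∈K  = K-chain x y x∈K y∈K
  ... | inj₁ x∈K  | inj₂ refl = z-comparable x x∈K
  ... | inj₂ refl | inj₁ y∈K  = Sum.swap (z-comparable y y∈K)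
  ... | inj₂ refl | inj₂ refl = inj₁ ≤-refl

module _ {n} {L : Elt n → Set} where

  ≤⇒meet : ∀ {x y} → L y → y ≤ x → IsMeet L x y y
  ≤⇒meet y∈L y≤x = y∈L , y≤x , ≤-refl , λ _ _ _ w≤y → w≤y

  ≤⇒join : ∀ {x y} → L x → y ≤ x → IsJoin L x y x
  ≤⇒join x∈L y≤x = x∈L , ≤-refl , y≤x , λ _ _ x≤w _ → x≤w

  modular-inequality : ∀ {a b c d e f g} → L b → b ≤ c →
    IsJoin L b a d → IsMeet L d c e → IsMeet L a c f → IsJoin L b f g → g ≤ e
  modular-inequality b∈L b≤c (_ , b≤d , a≤d , _) (e∈L , _ , _ , e-greatest)
                     (f∈L , f≤a , f≤c , _) (_ , _ , _ , g-least) =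
    g-least _ e∈L (e-greatest _ b∈L b≤d b≤c) (e-greatest _ f∈L (≤-trans f≤a a≤d) f≤c)

  leftModular-≤ : ∀ {a b c d e f g} → LeftModularElem L a → L b → L c → b ≤ c →
    IsJoin L b a d → IsMeet L d c e → IsMeet L a c f → IsJoin L b f g → e ≡ g
  leftModular-≤ {b = b} {c} (_ , modular) b∈L c∈L b≤c jd me mf jg with b ≟ c
  ... | no b≢c = modular _ _ b∈L c∈L (b≤c , b≢c) _ _ _ _ jd me mf jg
  ... | yes refl =
    ≤-antisym (≤-trans (proj₁ (proj₂ (proj₂ me))) (proj₁ (proj₂ jg)))
              (modular-inequality b∈L b≤c jd me mf jg)

DownSet? : ∀ {n} {L : Elt n → Set} → (∀ x → Dec (L x)) → (C : Subset n) → ∀ y → Dec (DownSet L C y)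
DownSet? L? C y = L? y ×-dec ∃? (λ x → T? (C x) ×-dec y ≤? x)

E? : ∀ {n} (D : Doublings n) x → Dec (E D x)
E? ε       []          = yes tt
E? (D ▷ C) (false ∷ x) = DownSet? (E? D) C x
E? (D ▷ C) (true ∷ x)  = (E? D x ×-dec ¬? (DownSet? (E? D) C x)) ⊎-dec T? (C x)

module Doubling {n} (D : Doublings n) (C : Subset n) (convex : Convex (E D) C) where

  L : Elt n → Set
  L = E D

  L′ : Elt (Nat.suc n) → Set
  L′ = E (D ▷ C)

  I : Elt n → Set
  I = DownSet L C

  I? : ∀ x → Dec (I x)
  I? = DownSet? (E? D) C

  C⊆L : ∀ {x} → x ∈ C → L x
  C⊆L = proj₁ convex _

  base : ∀ {i x} → L′ (i ∷ x) → L x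
  base {false} (x∈L , _)         = x∈L
  base {true}  (inj₁ (x∈L , _))  = x∈L
  base {true}  (inj₂ x∈C)        = C⊆L x∈C

  I-downward : ∀ {z w} → L z → z ≤ w → I w → I z
  I-downward z∈L z≤w (_ , c , c∈C , w≤c) = z∈L , c , c∈C , ≤-trans z≤w w≤c

  C⊆I : ∀ {x} → x ∈ C → I x
  C⊆I x∈C = C⊆L x∈C , _ , x∈C , ≤-refl

  I-above-C⊆C : ∀ {c z} → c ∈ C → c ≤ z → I z → z ∈ C
  I-above-C⊆C c∈C c≤z (z∈L , _ , c′∈C , z≤c′) = proj₂ convex _ _ _ c∈C c′∈C z∈L c≤z z≤c′

  doubled⇒∈C : ∀ {z} → L′ (false ∷ z) → L′ (true ∷ z) → z ∈ C
  doubled⇒∈C z∈I (inj₁ (_ , z∉I)) = ⊥-elim (z∉I z∈I)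
  doubled⇒∈C _   (inj₂ z∈C)       = z∈C

  upper-upward : ∀ {w z} → L′ (true ∷ w) → w ≤ z → L z → L′ (true ∷ z)
  upper-upward {z = z} _ _ z∈L with I? z
  ... | no z∉I = inj₁ (z∈L , z∉I)
  upper-upward (inj₁ (w∈L , w∉I)) w≤z _ | yes z∈I = ⊥-elim (w∉I (I-downward w∈L w≤z z∈I))
  upper-upward (inj₂ w∈C)         w≤z _ | yes z∈I = inj₂ (I-above-C⊆C w∈C w≤z z∈I)

  ∉upper⇒I : ∀ {z} → L z → ¬ L′ (true ∷ z) → I z
  ∉upper⇒I {z} z∈L z∉ = decidable-stable (I? z) (λ z∉I → z∉ (inj₁ (z∈L , z∉I)))

  ∉I⇒upper : ∀ {l z} → ¬ I z → L′ (l ∷ z) → true ≤𝔹 l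
  ∉I⇒upper {false} z∉I z∈I = ⊥-elim (z∉I z∈I)
  ∉I⇒upper {true}  _   _   = b≤b

  join-lift : ∀ {x y z i j k} → IsJoin L x y z → L′ (k ∷ z) → i ≤𝔹 k → j ≤𝔹 k →
    (∀ {l} → L′ (l ∷ z) → i ≤𝔹 l → j ≤𝔹 l → k ≤𝔹 l) → IsJoin L′ (i ∷ x) (j ∷ y) (k ∷ z)
  join-lift {z = z} {i} {j} {k} (z∈L , x≤z , y≤z , z-least) k∈ i≤k j≤k k-least =
    k∈ , i≤k ∷ x≤z , j≤k ∷ y≤z ,
    λ { (l ∷ w) w∈ (i≤l ∷ x≤w) (j≤l ∷ y≤w) →
          k≤ w∈ (z-least w (base w∈) x≤w y≤w) i≤l j≤l ∷ z-least w (base w∈) x≤w y≤w }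
    where
    k≤ : ∀ {l w} → L′ (l ∷ w) → z ≤ w → i ≤𝔹 l → j ≤𝔹 l → k ≤𝔹 l
    k≤ {true}  _   _   _   _   = 𝔹.≤-maximum k
    k≤ {false} w∈I z≤w i≤l j≤l = k-least (I-downward z∈L z≤w w∈I) i≤l j≤l

  meet-lift : ∀ {x y z i j k} → IsMeet L x y z → L′ (k ∷ z) → k ≤𝔹 i → k ≤𝔹 j →
    (∀ {l} → L′ (l ∷ z) → l ≤𝔹 i → l ≤𝔹 j → l ≤𝔹 k) → IsMeet L′ (i ∷ x) (j ∷ y) (k ∷ z)
  meet-lift {z = z} {i} {j} {k} (z∈L , z≤x , z≤y , z-greatest) k∈ k≤i k≤j k-greatest =
    k∈ , k≤i ∷ z≤x , k≤j ∷ z≤y ,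
    λ { (l ∷ w) w∈ (l≤i ∷ w≤x) (l≤j ∷ w≤y) →
          ≤k w∈ (z-greatest w (base w∈) w≤x w≤y) l≤i l≤j ∷ z-greatest w (base w∈) w≤x w≤y }
    where
    ≤k : ∀ {l w} → L′ (l ∷ w) → w ≤ z → l ≤𝔹 i → l ≤𝔹 j → l ≤𝔹 k
    ≤k {false} _  _   _   _   = 𝔹.≤-minimum k
    ≤k {true}  w∈ w≤z l≤i l≤j = k-greatest (upper-upward w∈ w≤z z∈L) l≤i l≤j

  join-level : ∀ {x y z i j} → IsJoin L x y z → L′ (i ∷ x) → L′ (j ∷ y) →
    ∃[ k ] IsJoin L′ (i ∷ x) (j ∷ y) (k ∷ z)
  join-level {i = true} jz@(z∈L , x≤z , _) x∈ _ =
    true , join-lift jz (upper-upward x∈ x≤z z∈L) b≤b (𝔹.≤-maximum _) (λ _ i≤l _ → i≤l)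
  join-level {i = false} {true} jz@(z∈L , _ , y≤z , _) _ y∈ =
    true , join-lift jz (upper-upward y∈ y≤z z∈L) f≤t b≤b (λ _ _ j≤l → j≤l)
  join-level {z = z} {false} {false} jz _ _ with I? z
  ... | yes z∈I = false , join-lift jz z∈I b≤b b≤b (λ _ _ _ → 𝔹.≤-minimum _)
  ... | no z∉I  = true , join-lift jz (inj₁ (proj₁ jz , z∉I)) f≤t f≤t (λ z∈ _ _ → ∉I⇒upper z∉I z∈)

  meet-level : ∀ {x y z i j} → IsMeet L x y z → L′ (i ∷ x) → L′ (j ∷ y) →
    ∃[ k ] IsMeet L′ (i ∷ x) (j ∷ y) (k ∷ z)
  meet-level {i = false} mz@(z∈L , z≤x , _) x∈ _ =
    false , meet-lift mz (I-downward z∈L z≤x x∈) b≤b (𝔹.≤-minimum _) (λ _ l≤i _ → l≤i)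
  meet-level {i = true} {false} mz@(z∈L , _ , z≤y , _) _ y∈ =
    false , meet-lift mz (I-downward z∈L z≤y y∈) f≤t b≤b (λ _ _ l≤j → l≤j)
  meet-level {z = z} {true} {true} mz _ _ with E? (D ▷ C) (true ∷ z)
  ... | yes z∈ = true , meet-lift mz z∈ b≤b b≤b (λ _ _ _ → 𝔹.≤-maximum _)
  ... | no z∉  = false , meet-lift mz (∉upper⇒I (proj₁ mz) z∉) f≤t f≤t
                   (λ { {false} _ _ _ → b≤b ; {true} z∈ _ _ → ⊥-elim (z∉ z∈) })

  upper-bound-lift : ∀ {x y w i j} → L′ (i ∷ x) → L′ (j ∷ y) → L w → x ≤ w → y ≤ w →
    ∃[ l ] L′ (l ∷ w) × i ≤𝔹 l × j ≤𝔹 l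
  upper-bound-lift {w = w} {i} {j} x∈ y∈ w∈L x≤w y≤w with E? (D ▷ C) (true ∷ w)
  ... | yes w∈ = true , w∈ , 𝔹.≤-maximum i , 𝔹.≤-maximum j
  ... | no w∉  = false , ∉upper⇒I w∈L w∉ , lower x∈ x≤w , lower y∈ y≤w
    where
    lower : ∀ {i x} → L′ (i ∷ x) → x ≤ w → i ≤𝔹 false
    lower {false} _  _   = b≤b
    lower {true}  x∈ x≤w = ⊥-elim (w∉ (upper-upward x∈ x≤w w∈L))

  lower-bound-lift : ∀ {x y w i j} → L′ (i ∷ x) → L′ (j ∷ y) → L w → w ≤ x → w ≤ y →
    ∃[ l ] L′ (l ∷ w) × l ≤𝔹 i × l ≤𝔹 j
  lower-bound-lift {w = w} {i} {j} x∈ y∈ w∈L w≤x w≤y with I? w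
  ... | yes w∈I = false , w∈I , 𝔹.≤-minimum i , 𝔹.≤-minimum j
  ... | no w∉I  = true , inj₁ (w∈L , w∉I) , upper x∈ w≤x , upper y∈ w≤y
    where
    upper : ∀ {i x} → L′ (i ∷ x) → w ≤ x → true ≤𝔹 i
    upper {true}  _   _   = b≤b
    upper {false} x∈I w≤x = ⊥-elim (w∉I (I-downward w∈L w≤x x∈I))

  join-base : ∀ {x y z i j k} → L′ (i ∷ x) → L′ (j ∷ y) →
    IsJoin L′ (i ∷ x) (j ∷ y) (k ∷ z) → IsJoin L x y z
  join-base x∈ y∈ (z∈ , _ ∷ x≤z , _ ∷ y≤z , least) =
    base z∈ , x≤z , y≤z , λ w w∈L x≤w y≤w →
      let l , w∈ , i≤l , j≤l = upper-bound-lift x∈ y∈ w∈L x≤w y≤w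
      in  Pw.tail (least (l ∷ w) w∈ (i≤l ∷ x≤w) (j≤l ∷ y≤w))

  meet-base : ∀ {x y z i j k} → L′ (i ∷ x) → L′ (j ∷ y) →
    IsMeet L′ (i ∷ x) (j ∷ y) (k ∷ z) → IsMeet L x y z
  meet-base x∈ y∈ (z∈ , _ ∷ z≤x , _ ∷ z≤y , greatest) =
    base z∈ , z≤x , z≤y , λ w w∈L w≤x w≤y →
      let l , w∈ , l≤i , l≤j = lower-bound-lift x∈ y∈ w∈L w≤x w≤y
      in  Pw.tail (greatest (l ∷ w) w∈ (l≤i ∷ w≤x) (l≤j ∷ w≤y))

  monotone-lift : ∀ {b c} → L b → L c → b ≤ c → ∃₂ λ β γ → L′ (β ∷ b) × L′ (γ ∷ c) × β ≤𝔹 γ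
  monotone-lift {b} {c} b∈L c∈L b≤c with I? b | I? c
  ... | yes b∈I | yes c∈I = false , false , b∈I , c∈I , b≤b
  ... | yes b∈I | no c∉I  = false , true , b∈I , inj₁ (c∈L , c∉I) , f≤t
  ... | no b∉I  | _       = true , true , inj₁ (b∈L , b∉I) , inj₁ (c∈L , b∉I ∘ I-downward b∈L b≤c) , b≤b

  leftModular-base : ∀ {i x} → LeftModularElem L′ (i ∷ x) → LeftModularElem L x
  leftModular-base (a∈ , modular) = base a∈ , λ b c b∈L c∈L (b≤c , b≢c) _ _ _ _ jd me mf jg →
    let _ , _ , b∈ , c∈ , β≤γ = monotone-lift b∈L c∈L b≤c
        _ , jd′ = join-level jd b∈ a∈
        _ , me′ = meet-level me (proj₁ jd′) c∈
        _ , mf′ = meet-level mf a∈ c∈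
        _ , jg′ = join-level jg b∈ (proj₁ mf′)
    in  cong Vec.tail (modular _ _ b∈ c∈ (β≤γ ∷ b≤c , b≢c ∘ cong Vec.tail) _ _ _ _ jd′ me′ mf′ jg′)

  NoLevelDrop : Elt (Nat.suc n) → Set
  NoLevelDrop a = ∀ {b′ c′ d′ f′ e} → L′ b′ → L′ c′ → IsJoin L′ b′ a d′ →
    IsMeet L′ d′ c′ (true ∷ e) → IsMeet L′ a c′ f′ → ¬ IsJoin L′ b′ f′ (false ∷ e)

  leftModular-lift : ∀ {i x} → LeftModularElem L x → L′ (i ∷ x) → NoLevelDrop (i ∷ x) →
    LeftModularElem L′ (i ∷ x)
  leftModular-lift {i} {x} x-modular a∈ noDrop = a∈ , modular
    where
    modular : ∀ b′ c′ → L′ b′ → L′ c′ → b′ < c′ → ∀ d′ e′ f′ g′ → IsJoin L′ b′ (i ∷ x) d′ →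
      IsMeet L′ d′ c′ e′ → IsMeet L′ (i ∷ x) c′ f′ → IsJoin L′ b′ f′ g′ → e′ ≡ g′
    modular (_ ∷ b) (_ ∷ c) b∈ c∈ (b′≤c′@(_ ∷ b≤c) , _) (_ ∷ _) (_ ∷ e) (_ ∷ _) (_ ∷ g) jd me mf jg
      with leftModular-≤ x-modular (base b∈) (base c∈) b≤c (join-base b∈ a∈ jd)
             (meet-base (proj₁ jd) c∈ me) (meet-base a∈ c∈ mf) (join-base b∈ (proj₁ mf) jg)
         | Pw.head (modular-inequality b∈ b′≤c′ jd me mf jg)
    ... | refl | b≤b = refl
    ... | refl | f≤t = ⊥-elim (noDrop b∈ c∈ jd me mf jg)

  lower-noLevelDrop : ∀ {h x} → Heart C h → x ≤ h → L′ (false ∷ x) → NoLevelDrop (false ∷ x)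
  lower-noLevelDrop _ _ _ {true ∷ _} _ _ _ _ _ (_ , () ∷ _ , _)
  lower-noLevelDrop (_ , h≤maximal , _) x≤h a∈ {false ∷ b} {d′ = _ ∷ d} {e = e}
                    b∈ _ jd@(_ , _ , _ , d′-least) me _ (e∈I , _ ∷ b≤e , _) =
    let m , e≤m , m∈C , m-maximal = maximal-above C e (doubled⇒∈C e∈I (proj₁ me))
        d∈L , b≤d , x≤d , d-least = join-base b∈ a∈ jd
        d≤m = d-least m (C⊆L m∈C) (≤-trans b≤e e≤m) (≤-trans x≤h (h≤maximal m (m∈C , m-maximal)))
        d′≤d = d′-least (false ∷ d) (d∈L , m , m∈C , d≤m) (b≤b ∷ b≤d) (b≤b ∷ x≤d)
    in  true≰false (Pw.head (≤-trans (proj₁ (proj₂ me)) d′≤d))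

  upper-noLevelDrop : ∀ {h x} → Heart C h → h ≤ x → L′ (true ∷ x) → NoLevelDrop (true ∷ x)
  upper-noLevelDrop _ _ _ {f′ = true ∷ _} _ _ _ _ _ (_ , _ , () ∷ _ , _)
  upper-noLevelDrop (_ , _ , minimal≤h) h≤x a∈ {c′ = _ ∷ c} {f′ = false ∷ f} {e}
                    _ c∈ _ me@(_ , _ , e′≤c′ , _) mf@(_ , _ , _ , f′-greatest) (e∈I , _ , _ ∷ f≤e , _) =
    let e∈C = doubled⇒∈C e∈I (proj₁ me)
        m , m≤e , m∈C , m-minimal = minimal-below C e e∈C
        f∈L , f≤x , f≤c , f-greatest = meet-base a∈ c∈ mf
        m≤f = f-greatest m (C⊆L m∈C) (≤-trans (minimal≤h m (m∈C , m-minimal)) h≤x)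
                         (≤-trans m≤e (Pw.tail e′≤c′))
        f∈C = proj₂ convex _ _ _ m∈C e∈C f∈L m≤f f≤e
    in  true≰false (Pw.head (f′-greatest (true ∷ f) (inj₂ f∈C) (b≤b ∷ f≤x) (Pw.head e′≤c′ ∷ f≤c)))

  leftModular-at-doubled : ∀ {a c d′ f′} → LeftModularElem L′ a → c ∈ C →
    IsJoin L′ (false ∷ c) a d′ → IsMeet L′ a (true ∷ c) f′ → (true ∷ c) ≤ d′ → ¬ f′ ≤ (false ∷ c)
  leftModular-at-doubled (_ , modular) c∈C jd mf c₁≤d′ f′≤c₀ =
    true≰false (𝔹.≤-reflexive (cong Vec.head (modular _ _ (C⊆I c∈C) (inj₂ c∈C) (f≤t ∷ ≤-refl , λ ())
      _ _ _ _ jd (≤⇒meet (inj₂ c∈C) c₁≤d′) mf (≤⇒join (C⊆I c∈C) f′≤c₀))))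

  module MaximalChain {K′ : Subset (Nat.suc n)} (K′-maximal : IsMaximalChain L′ K′) where

    K′⊆L′ : ∀ z → z ∈ K′ → L′ z
    K′⊆L′ = proj₁ (proj₁ K′-maximal)

    K′-chain : ∀ z z′ → z ∈ K′ → z′ ∈ K′ → z ≤ z′ ⊎ z′ ≤ z
    K′-chain = proj₂ (proj₁ K′-maximal)

    lower≤upper : ∀ {x y} → (false ∷ x) ∈ K′ → (true ∷ y) ∈ K′ → x ≤ y
    lower≤upper x∈ y∈ with K′-chain _ _ x∈ y∈
    ... | inj₁ (_ ∷ x≤y) = x≤y
    ... | inj₂ (() ∷ _)

    upper-∈ : ∀ {w} → L′ (true ∷ w) → (∀ x → (false ∷ x) ∈ K′ → x ≤ w) →
      (∀ y → (true ∷ y) ∈ K′ → y ≤ w ⊎ w ≤ y) → (true ∷ w) ∈ K′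
    upper-∈ w∈ lower≤w upper~w = comparable-∈-maximalChain K′-maximal w∈ λ where
      (false ∷ x) x∈ → inj₁ (f≤t ∷ lower≤w x x∈)
      (true ∷ y)  y∈ → Sum.map (b≤b ∷_) (b≤b ∷_) (upper~w y y∈)

    lower-∈ : ∀ {w} → I w → (∀ x → (false ∷ x) ∈ K′ → x ≤ w ⊎ w ≤ x) →
      (∀ y → (true ∷ y) ∈ K′ → w ≤ y) → (false ∷ w) ∈ K′
    lower-∈ w∈I lower~w w≤upper = comparable-∈-maximalChain K′-maximal w∈I λ where
      (false ∷ x) x∈ → Sum.map (b≤b ∷_) (b≤b ∷_) (lower~w x x∈)
      (true ∷ y)  y∈ → inj₂ (f≤t ∷ w≤upper y y∈)

    upper-minimum : ∃[ y ] (true ∷ y) ∈ K′ → ∃[ y ] (true ∷ y) ∈ K′ × (∀ y′ → (true ∷ y′) ∈ K′ → y ≤ y′)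
    upper-minimum (y₀ , y₀∈) =
      let y , _ , y∈ , y-minimal = minimal-below (λ y → K′ (true ∷ y)) y₀ y₀∈
      in  y , y∈ , λ y′ y′∈ →
            [ Pw.tail , (λ y′≤y → ≤-reflexive (sym (y-minimal y′ y′∈ (Pw.tail y′≤y)))) ]′
                                 (K′-chain _ _ y∈ y′∈)

    base-chain : Subset n
    base-chain x = K′ (false ∷ x) ∨ K′ (true ∷ x)

    ∈base-chain : ∀ {x} → x ∈ base-chain → ∃[ i ] (i ∷ x) ∈ K′
    ∈base-chain = [ (false ,_) , (true ,_) ]′ ∘ Equivalence.to 𝔹.T-∨

    base-chain∋ : ∀ {i x} → (i ∷ x) ∈ K′ → x ∈ base-chain
    base-chain∋ {false} = Equivalence.from 𝔹.T-∨ ∘ inj₁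
    base-chain∋ {true}  = Equivalence.from 𝔹.T-∨ ∘ inj₂

    base-chain-closed : ∀ {w} → L w → (∀ x → x ∈ base-chain → x ≤ w ⊎ w ≤ x) → w ∈ base-chain
    base-chain-closed {w} w∈L w~ with ∃? (λ y → T? (K′ (true ∷ y)) ×-dec y ≤? w)
    ... | yes (y , y∈ , y≤w) =
      base-chain∋ (upper-∈ (upper-upward (K′⊆L′ _ y∈) y≤w w∈L)
                           (λ x x∈ → ≤-trans (lower≤upper x∈ y∈) y≤w)
                           (λ y′ y′∈ → w~ y′ (base-chain∋ y′∈)))
    ... | no ∄y with I? w
    ...   | yes w∈I =
      base-chain∋ (lower-∈ w∈I (λ x x∈ → w~ x (base-chain∋ x∈))
                           (λ y y∈ → [ (λ y≤w → ⊥-elim (∄y (y , y∈ , y≤w))) , id ]′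
                                        (w~ y (base-chain∋ y∈))))
    ...   | no w∉I =
      base-chain∋ (upper-∈ (inj₁ (w∈L , w∉I))
                           (λ x x∈ → [ id
                                     , (λ w≤x → ⊥-elim (w∉I (I-downward w∈L w≤x (K′⊆L′ _ x∈)))) ]′
                                        (w~ x (base-chain∋ x∈)))
                           (λ y y∈ → w~ y (base-chain∋ y∈)))

    base-chain-maximal : IsMaximalChain L base-chain
    base-chain-maximal = (⊆L , chain) , λ K″ (K″⊆L , K″-chain) ⊆K″ w w∈K″ →
      base-chain-closed (K″⊆L w w∈K″) (λ x x∈ → K″-chain x w (⊆K″ x x∈) w∈K″)
      where
      ⊆L : ∀ x → x ∈ base-chain → L x
      ⊆L x x∈ = base (K′⊆L′ _ (proj₂ (∈base-chain x∈)))

      chain : ∀ x y → x ∈ base-chain → y ∈ base-chain → x ≤ y ⊎ y ≤ x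
      chain x y x∈ y∈ =
        Sum.map Pw.tail Pw.tail (K′-chain _ _ (proj₂ (∈base-chain x∈)) (proj₂ (∈base-chain y∈)))

    base-chain-leftModular : (∀ z → z ∈ K′ → LeftModularElem L′ z) →
      IsMaximalLeftModularChain L base-chain
    base-chain-leftModular K′-modular =
      base-chain-maximal , λ x x∈ → leftModular-base (K′-modular _ (proj₂ (∈base-chain x∈)))

  module _ (join : ∀ {x y} → L x → L y → ∃ (IsJoin L x y))
           (meet : ∀ {x y} → L x → L y → ∃ (IsMeet L x y)) where

    leftModular⇒join∈I : ∀ {x c z} → LeftModularElem L′ (false ∷ x) → c ∈ C → IsJoin L c x z → I z
    leftModular⇒join∈I {z = z} a-modular@(a∈ , _) c∈C jz@(z∈L , c≤z , _) =
      decidable-stable (I? z) λ z∉I →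
        let _ , mu@(_ , _ , u≤c , _) = meet (base a∈) (C⊆L c∈C)
            _ , mf@(_ , f′≤a , _) = meet-level mu a∈ (inj₂ c∈C)
            jd = join-lift jz (inj₁ (z∈L , z∉I)) f≤t f≤t (λ z∈ _ _ → ∉I⇒upper z∉I z∈)
        in  leftModular-at-doubled a-modular c∈C jd mf (b≤b ∷ c≤z) (Pw.head f′≤a ∷ u≤c)

    leftModular⇒meet∈C : ∀ {y c u} → LeftModularElem L′ (true ∷ y) → c ∈ C → IsMeet L y c u → u ∈ C
    leftModular⇒meet∈C {u = u} a-modular@(a∈ , _) c∈C mu@(u∈L , _ , u≤c , _) =
      decidable-stable (T? (C u)) λ u∉C →
        let _ , jz@(_ , c≤z , _) = join (C⊆L c∈C) (base a∈)
            _ , jd@(_ , _ , a≤d′ , _) = join-level jz (C⊆I c∈C) a∈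
            u∈I = I-downward u∈L u≤c (C⊆I c∈C)
            mf = meet-lift mu u∈I f≤t f≤t
                   (λ { {false} _ _ _ → b≤b ; {true} u∈ _ _ → ⊥-elim (u∉C (doubled⇒∈C u∈I u∈)) })
        in  leftModular-at-doubled a-modular c∈C jd mf (Pw.head a≤d′ ∷ c≤z) (b≤b ∷ u≤c)

    leftModular⇒≤maximal : ∀ {x m} → LeftModularElem L′ (false ∷ x) → IsMaximalIn C m → x ≤ m
    leftModular⇒≤maximal {x} a-modular (m∈C , m-maximal) =
      let z , jz@(_ , m≤z , x≤z , _) = join (C⊆L m∈C) (base (proj₁ a-modular))
          z∈C = I-above-C⊆C m∈C m≤z (leftModular⇒join∈I a-modular m∈C jz)
      in  subst (x ≤_) (m-maximal z z∈C m≤z) x≤z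

    leftModular⇒≥minimal : ∀ {y m} → LeftModularElem L′ (true ∷ y) → IsMinimalIn C m → m ≤ y
    leftModular⇒≥minimal {y} a-modular (m∈C , m-minimal) =
      let u , mu@(_ , u≤y , u≤m , _) = meet (base (proj₁ a-modular)) (C⊆L m∈C)
      in  subst (_≤ y) (m-minimal u (leftModular⇒meet∈C a-modular m∈C mu) u≤m) u≤y

    doubled-leftModular⇒heart : ∀ {h} → LeftModularElem L′ (false ∷ h) → LeftModularElem L′ (true ∷ h) →
      Heart C h
    doubled-leftModular⇒heart h₀-modular h₁-modular =
      doubled⇒∈C (proj₁ h₀-modular) (proj₁ h₁-modular) ,
      (λ _ → leftModular⇒≤maximal h₀-modular) , (λ _ → leftModular⇒≥minimal h₁-modular)

    module _ {K′ : Subset (Nat.suc n)} (K′-maximal : IsMaximalChain L′ K′)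
             (K′-modular : ∀ z → z ∈ K′ → LeftModularElem L′ z) where
      open MaximalChain K′-maximal

      lower≤maximal : ∀ {m} → IsMaximalIn C m → ∀ x → (false ∷ x) ∈ K′ → x ≤ m
      lower≤maximal m-maximal x x∈ = leftModular⇒≤maximal (K′-modular _ x∈) m-maximal

      upper-nonempty : ∀ {m} → IsMaximalIn C m → ∃[ y ] (true ∷ y) ∈ K′
      upper-nonempty m-maximal@(m∈C , _) =
        decidable-stable (∃? (λ y → T? (K′ (true ∷ y)))) λ ∄upper →
          ∄upper (_ , upper-∈ (inj₂ m∈C) (lower≤maximal m-maximal) (λ y y∈ → ⊥-elim (∄upper (y , y∈))))

      -- With y the least upper element of K′ and m maximal in C, the chain crosses levels at y ∧ m.
      crossing : ∀ {c} → c ∈ C → ∃[ h ] (false ∷ h) ∈ K′ × (true ∷ h) ∈ K′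
      crossing c∈C =
        let m , _ , m-maximal@(m∈C , _) = maximal-above C _ c∈C
            y , y∈ , y≤upper = upper-minimum (upper-nonempty m-maximal)
            u , mu@(_ , u≤y , _ , u-greatest) = meet (base (K′⊆L′ _ y∈)) (C⊆L m∈C)
            u∈C = leftModular⇒meet∈C (K′-modular _ y∈) m∈C mu
            lower≤u = λ x x∈ →
              u-greatest x (base (K′⊆L′ _ x∈)) (lower≤upper x∈ y∈) (lower≤maximal m-maximal x x∈)
            u≤upper = λ y′ y′∈ → ≤-trans u≤y (y≤upper y′ y′∈)
        in  u , lower-∈ (C⊆I u∈C) (λ x x∈ → inj₁ (lower≤u x x∈)) u≤upper
              , upper-∈ (inj₂ u∈C) lower≤u (λ y′ y′∈ → inj₂ (u≤upper y′ y′∈))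

  module Lift {h} (h∈heart : Heart C h)
              {K : Subset n} (K-maximal : IsMaximalChain L K) (h∈K : h ∈ K) where

    Side : Bool → Elt n → Set
    Side false x = x ≤ h
    Side true  x = h ≤ x

    Side? : ∀ i x → Dec (Side i x)
    Side? false x = x ≤? h
    Side? true  x = h ≤? x

    Side-refl : ∀ i → Side i h
    Side-refl false = ≤-refl
    Side-refl true  = ≤-refl

    lifted : Subset (Nat.suc n)
    lifted (i ∷ x) = K x ∧ isYes (Side? i x)

    ∈lifted : ∀ i {x} → (i ∷ x) ∈ lifted → x ∈ K × Side i x
    ∈lifted i {x} p∈ = let x∈K , side = Equivalence.to (𝔹.T-∧ {K x}) p∈ in x∈K , toWitness side

    lifted∋ : ∀ i {x} → x ∈ K → Side i x → (i ∷ x) ∈ lifted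
    lifted∋ i {x} x∈K side = Equivalence.from 𝔹.T-∧ (x∈K , fromWitness {a? = Side? i x} side)

    K⊆L : ∀ x → x ∈ K → L x
    K⊆L = proj₁ (proj₁ K-maximal)

    K-chain : ∀ x y → x ∈ K → y ∈ K → x ≤ y ⊎ y ≤ x
    K-chain = proj₂ (proj₁ K-maximal)

    lifted⊆L′ : ∀ z → z ∈ lifted → L′ z
    lifted⊆L′ (false ∷ x) p∈ = let x∈K , x≤h = ∈lifted false p∈ in K⊆L x x∈K , h , proj₁ h∈heart , x≤h
    lifted⊆L′ (true ∷ x)  p∈ =
      let x∈K , h≤x = ∈lifted true p∈ in upper-upward (inj₂ (proj₁ h∈heart)) h≤x (K⊆L x x∈K)

    lifted-chain : ∀ p q → p ∈ lifted → q ∈ lifted → p ≤ q ⊎ q ≤ p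
    lifted-chain (i ∷ x) (j ∷ y) p∈ q∈ = compare i j (∈lifted i p∈) (∈lifted j q∈)
      where
      compare : ∀ i j → x ∈ K × Side i x → y ∈ K × Side j y → (i ∷ x) ≤ (j ∷ y) ⊎ (j ∷ y) ≤ (i ∷ x)
      compare false false (x∈K , _)   (y∈K , _)   = Sum.map (b≤b ∷_) (b≤b ∷_) (K-chain x y x∈K y∈K)
      compare true  true  (x∈K , _)   (y∈K , _)   = Sum.map (b≤b ∷_) (b≤b ∷_) (K-chain x y x∈K y∈K)
      compare false true  (_   , x≤h) (_   , h≤y) = inj₁ (f≤t ∷ ≤-trans x≤h h≤y)
      compare true  false (_   , h≤x) (_   , y≤h) = inj₂ (f≤t ∷ ≤-trans y≤h h≤x)

    lift : ∀ {x} → x ∈ K → ∃[ i ] (i ∷ x) ∈ lifted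
    lift {x} x∈K = [ (λ x≤h → false , lifted∋ false x∈K x≤h) , (λ h≤x → true , lifted∋ true x∈K h≤x) ]′
                     (K-chain x h x∈K h∈K)

    lifted-maximal : IsMaximalChain L′ lifted
    lifted-maximal = (lifted⊆L′ , lifted-chain) , maximal
      where
      side : ∀ k {w} → (k ∷ w) ≤ (not k ∷ h) ⊎ (not k ∷ h) ≤ (k ∷ w) → Side k w
      side false (inj₁ (_ ∷ w≤h)) = w≤h
      side false (inj₂ (() ∷ _))
      side true  (inj₁ (() ∷ _))
      side true  (inj₂ (_ ∷ h≤w)) = h≤w

      maximal : ∀ K″ → IsChain L′ K″ → (∀ z → z ∈ lifted → z ∈ K″) → ∀ z → z ∈ K″ → z ∈ lifted
      maximal K″ (K″⊆L′ , K″-chain) ⊆K″ (k ∷ w) w∈K″ =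
        let w∈K = comparable-∈-maximalChain K-maximal (base (K″⊆L′ _ w∈K″)) λ x x∈K →
                    Sum.map Pw.tail Pw.tail (K″-chain _ _ (⊆K″ _ (proj₂ (lift x∈K))) w∈K″)
        in  lifted∋ k w∈K (side k (K″-chain _ _ w∈K″ (⊆K″ _ (lifted∋ (not k) h∈K (Side-refl (not k))))))

    lifted-leftModular : (∀ x → x ∈ K → LeftModularElem L x) → ∀ z → z ∈ lifted → LeftModularElem L′ z
    lifted-leftModular K-modular (false ∷ x) p∈ =
      let x∈K , x≤h = ∈lifted false p∈; a∈ = lifted⊆L′ _ p∈
      in  leftModular-lift (K-modular x x∈K) a∈ (lower-noLevelDrop h∈heart x≤h a∈)
    lifted-leftModular K-modular (true ∷ x) p∈ =
      let x∈K , h≤x = ∈lifted true p∈; a∈ = lifted⊆L′ _ p∈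
      in  leftModular-lift (K-modular x x∈K) a∈ (upper-noLevelDrop h∈heart h≤x a∈)

join-exists : ∀ {n} (D : Doublings n) → AllSteps ValidStep D →
  ∀ {x y} → E D x → E D y → ∃ (IsJoin (E D) x y)
join-exists ε       _                  {[]} {[]} _ _ = [] , tt , [] , [] , λ { [] _ _ _ → [] }
join-exists (D ▷ C) (valid , convex , _) {_ ∷ x} {_ ∷ y} x∈ y∈ =
  let open Doubling D C convex
      z , jz = join-exists D valid (base x∈) (base y∈)
      k , jz′ = join-level jz x∈ y∈
  in  k ∷ z , jz′

meet-exists : ∀ {n} (D : Doublings n) → AllSteps ValidStep D →
  ∀ {x y} → E D x → E D y → ∃ (IsMeet (E D) x y)
meet-exists ε       _                  {[]} {[]} _ _ = [] , tt , [] , [] , λ { [] _ _ _ → [] }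
meet-exists (D ▷ C) (valid , convex , _) {_ ∷ x} {_ ∷ y} x∈ y∈ =
  let open Doubling D C convex
      z , mz = meet-exists D valid (base x∈) (base y∈)
      k , mz′ = meet-level mz x∈ y∈
  in  k ∷ z , mz′

leftModular⇒heartMeetsLMChain : ∀ {n} (D : Doublings n) → AllSteps ValidStep D →
  LeftModular (E D) → AllSteps HeartMeetsLMChain D
leftModular⇒heartMeetsLMChain ε       _ _ = tt
leftModular⇒heartMeetsLMChain (D ▷ C) (valid , convex , _ , c∈C) (_ , K′-maximal , K′-modular) =
  let open Doubling D C convex
      open MaximalChain K′-maximal
      h , h₀∈ , h₁∈ = crossing (join-exists D valid) (meet-exists D valid) K′-maximal K′-modular c∈C
      heart = doubled-leftModular⇒heart (join-exists D valid) (meet-exists D valid)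
                (K′-modular _ h₀∈) (K′-modular _ h₁∈)
      K-maximal-leftModular = base-chain-leftModular K′-modular
  in  leftModular⇒heartMeetsLMChain D valid (_ , K-maximal-leftModular)
    , h , heart , _ , K-maximal-leftModular , base-chain∋ h₀∈

heartMeetsLMChain⇒leftModular : ∀ {n} (D : Doublings n) → AllSteps ValidStep D →
  AllSteps HeartMeetsLMChain D → LeftModular (E D)
heartMeetsLMChain⇒leftModular ε _ _ =
  (λ _ → true) , (((λ { [] _ → tt }) , λ { [] [] _ _ → inj₁ [] }) , λ _ _ _ _ _ → tt) ,
  λ { [] _ → tt , λ { [] [] _ _ (_ , []≢[]) → ⊥-elim ([]≢[] refl) } }
heartMeetsLMChain⇒leftModular (D ▷ C) (_ , convex , _)
                              (_ , _ , h∈heart , _ , (K-maximal , K-modular) , h∈K) =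
  let open Doubling.Lift D C convex h∈heart K-maximal h∈K
  in  lifted , lifted-maximal , lifted-leftModular K-modular

theorem3p12 : ∀ (n : ℕ) (D : Doublings n) → AllSteps ValidStep D →
    (LeftModular (E D) ⇔ AllSteps HeartMeetsLMChain D)
theorem3p12 _ D valid =
  mk⇔ (leftModular⇒heartMeetsLMChain D valid) (heartMeetsLMChain⇒leftModular D valid)
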